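{- Let $G$ be a finite simple graph and $\bar G$ its complement. Then (a) $|\gamma^{\rm LD}(G)-\gamma^{\rm LD}(\bar G)|\le 1$; (b) if $G$ has no closed twins, $|\gamma^{\rm ID}(G)-\gamma^{\rm OD}(\bar G)|\le 1$; (c) if $G$ has no open twins, $|\gamma^{\rm OD}(G)-\gamma^{\rm ID}(\bar G)|\le 1$; (d) if $G$ has neither open nor closed twins, $|\gamma^{\rm FD}(G)-\gamma^{\rm FD}(\bar G)|\le1$, and, if moreover neither $G$ nor $\bar G$ has an isolated vertex, $|\gamma^{\rm FTD}(G)-\gamma^{\rm FTD}(\bar G)|\le 1$.
   Context: For a graph $G=(V,E)$, $N(v)$ denotes the open and $N[v]=N(v)\cup\{v\}$ the closed neighborhood of $v$. Open twins are two non-adjacent vertices $u,v$ with $N(u)=N(v)$; closed twins are two adjacent vertices with $N[u]=N[v]$. A set $C\subseteq V$ is dominating if $N[v]\cap C\ne\emptyset$ for all $v$, total-dominating if $N(v)\cap C\neq\emptyset$ for all $v$; locating (L) if the sets $N(v)\cap C$, $v\in V\setminus C$, are pairwise distinct; open-separating (O) if the sets $N(v)\cap C$, $v\in V$, are pairwise distinct; closed-separating (I) if the sets $N[v]\cap C$, $v\in V$, are pairwise distinct; full-separating (F) if both O and I. For $S\in\{L,O,I,F\}$, an SD-code is a dominating S-set and an STD-code is a total-dominating S-set; $\gamma^{\rm SD}(G)$, $\gamma^{\rm STD}(G)$ denote their minimum cardinalities (defined when such sets exist). -}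

module Defs where

open import Data.Nat using (ℕ; suc; _≤_)
open import Data.Bool using (Bool; true; false; not; _∧_; _∨_)
open import Data.Fin using (Fin; _≟_)
open import Data.Fin.Subset using (Subset; _∈_; _∉_; _∩_; ∣_∣; Nonempty)
open import Data.Vec using (tabulate)
open import Data.Product using (Σ; ∃; _×_; _,_)
open import Relation.Nullary using (¬_)
open import Relation.Nullary.Decidable using (⌊_⌋)
open import Relation.Binary.PropositionalEquality using (_≡_; _≢_)

record Graph (n : ℕ) : Set where
  field
    adj   : Fin n → Fin n → Bool
    sym   : ∀ u v → adj u v ≡ adj v u
    irrefl : ∀ v → adj v v ≡ false
open Graph public

complement : ∀ {n} → Graph n → Graph n
complement {n} G = record
  { adj = λ u v → not (adj G u v) ∧ not ⌊ u ≟ v ⌋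
  ; sym = λ u v → symm u v
  ; irrefl = λ v → irr v
  }
  where
  open import Relation.Binary.PropositionalEquality using (refl; cong₂; cong)
  open import Relation.Nullary using (yes; no)
  eqSym : ∀ (u v : Fin n) → ⌊ u ≟ v ⌋ ≡ ⌊ v ≟ u ⌋
  eqSym u v with u ≟ v | v ≟ u
  ... | yes _ | yes _ = refl
  ... | no _ | no _ = refl
  ... | yes p | no q = Data.Empty.⊥-elim (q (Relation.Binary.PropositionalEquality.sym p))
    where import Data.Empty
  ... | no p | yes q = Data.Empty.⊥-elim (p (Relation.Binary.PropositionalEquality.sym q))
    where import Data.Empty
  symm : ∀ u v → (not (adj G u v) ∧ not ⌊ u ≟ v ⌋) ≡ (not (adj G v u) ∧ not ⌊ v ≟ u ⌋)
  symm u v = cong₂ (λ a b → not a ∧ not b) (Graph.sym G u v) (eqSym u v)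
  irr : ∀ v → (not (adj G v v) ∧ not ⌊ v ≟ v ⌋) ≡ false
  irr v with v ≟ v
  ... | yes _ = Data.Bool.Properties.∧-zeroʳ (not (adj G v v))
    where import Data.Bool.Properties
  ... | no p = Data.Empty.⊥-elim (p refl)
    where import Data.Empty

module _ {n : ℕ} (G : Graph n) where

  N : Fin n → Subset n
  N v = tabulate (adj G v)

  N[_] : Fin n → Subset n
  N[ v ] = tabulate (λ w → adj G v w ∨ ⌊ v ≟ w ⌋)

  Dominating : Subset n → Set
  Dominating C = ∀ v → Nonempty (N[ v ] ∩ C)

  TotalDominating : Subset n → Set
  TotalDominating C = ∀ v → Nonempty (N v ∩ C)

  Locating : Subset n → Set
  Locating C = ∀ u v → u ∉ C → v ∉ C → u ≢ v → (N u ∩ C) ≢ (N v ∩ C)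

  OpenSeparating : Subset n → Set
  OpenSeparating C = ∀ u v → u ≢ v → (N u ∩ C) ≢ (N v ∩ C)

  ClosedSeparating : Subset n → Set
  ClosedSeparating C = ∀ u v → u ≢ v → (N[ u ] ∩ C) ≢ (N[ v ] ∩ C)

  FullSeparating : Subset n → Set
  FullSeparating C = OpenSeparating C × ClosedSeparating C

  HasOpenTwins : Set
  HasOpenTwins = Σ (Fin n) λ u → Σ (Fin n) λ v →
    u ≢ v × adj G u v ≡ false × N u ≡ N v

  HasClosedTwins : Set
  HasClosedTwins = Σ (Fin n) λ u → Σ (Fin n) λ v →
    u ≢ v × adj G u v ≡ true × N[ u ] ≡ N[ v ]

  HasIsolatedVertex : Set
  HasIsolatedVertex = Σ (Fin n) λ v → ∀ w → adj G v w ≡ false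

data Sep : Set where
  L O I F : Sep

Separating : Sep → ∀ {n} → Graph n → Subset n → Set
Separating L G = Locating G
Separating O G = OpenSeparating G
Separating I G = ClosedSeparating G
Separating F G = FullSeparating G

SDCode : Sep → ∀ {n} → Graph n → Subset n → Set
SDCode S G C = Dominating G C × Separating S G C

STDCode : Sep → ∀ {n} → Graph n → Subset n → Set
STDCode S G C = TotalDominating G C × Separating S G C

IsMinimum : ∀ {n} → (Subset n → Set) → ℕ → Set
IsMinimum P k = (∃ λ C → P C × ∣ C ∣ ≡ k) × (∀ C → P C → k ≤ ∣ C ∣)

γSD≡ : Sep → ∀ {n} → Graph n → ℕ → Set
γSD≡ S G k = IsMinimum (SDCode S G) k

γSTD≡ : Sep → ∀ {n} → Graph n → ℕ → Set
γSTD≡ S G k = IsMinimum (STDCode S G) k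

AbsDiff≤1 : ℕ → ℕ → Set
AbsDiff≤1 a b = a ≤ suc b × b ≤ suc a

DefinedAndClose : (ℕ → Set) → (ℕ → Set) → Set
DefinedAndClose P Q = ∃ λ a → ∃ λ b → P a × Q b × AbsDiff≤1 a b

{-# OPTIONS --safe #-}
-- On a vertex set C, the traces of neighbourhoods in the complement are relative complements
-- of traces in G: N_Ḡ(v) ∩ C = C ∖ N_G[v] and N_Ḡ[v] ∩ C = C ∖ N_G(v), while N[v] ∩ C = N(v) ∩ C
-- for v ∉ C. So C is locating (closed-, open-, full-separating) in G iff it is locating (open-,
-- closed-, full-separating) in Ḡ. Each such set is locating, hence leaves at most one vertex
-- undominated (two would share the empty trace); an open-separating set likewise leaves at most
-- one vertex without a neighbour in C. Adding that vertex, resp. one of its neighbours, gives a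
-- code, so each code of one graph yields a code of the other with at most one more vertex. Under
-- the twin-freeness hypotheses V itself is a code, so all the minima exist.
module Submission where

open import Defs
open import Data.Nat using (ℕ)
open import Data.Product using (_×_)
open import Relation.Nullary using (¬_)

import Algebra.Lattice.Properties.BooleanAlgebra as BooleanAlgebraProperties
open import Data.Bool using (true; false; not; _∧_; _∨_)
import Data.Bool as Bool
open import Data.Bool.Properties using (∨-∧-booleanAlgebra; ∨-identityʳ; ∨-zeroʳ; ∧-identityʳ; ∧-zeroʳ; ¬-not)
open import Data.Fin using (Fin; _≟_)
open import Data.Fin.Properties using (any?; all?)
open import Data.Fin.Subset using (Subset; _∈_; _∉_; _∩_; _∪_; ∁; ⊤; ⊥; ⁅_⁆; _⊆_; ∣_∣; Nonempty; Empty)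
open import Data.Fin.Subset.Properties using (∪-∩-booleanAlgebra; ∩-assoc; ∩-identityʳ; ∩-inverseˡ; ∩-distribʳ-∪; ∪-identityʳ; ⊆-refl; ⊆-antisym; p∩q⊆q; x∈p∩q⁺; x∈p∩q⁻; p⊆p∪q; q⊆p∪q; x∈⁅x⁆; ∣⁅x⁆∣≡1; ∈⊤; Empty-unique; nonempty?; anySubset?; _∈?_)
open import Data.Nat using (suc; _+_; _≤_; _<_; z≤n; s≤s)
open import Data.Nat.Induction using (<-wellFounded)
open import Data.Nat.Properties using (≤-trans; ≤-reflexive; n≤1+n; +-monoʳ-≤; +-suc; +-comm; ≮⇒≥; _<?_)
open import Data.Product using (∃; _,_; proj₁; proj₂; map₂; uncurry)
open import Data.Vec using ([]; _∷_; lookup)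
open import Data.Vec.Properties using (lookup∘tabulate; tabulate-cong; tabulate-∘; lookup-zipWith; []=⇒lookup; lookup⇒[]=; ≡-dec)
open import Data.Vec.Relation.Binary.Pointwise.Extensional using (ext; Pointwise-≡⇒≡)
open import Function using (_∘_)
open import Function.Bundles using (_⇔_; mk⇔; module Equivalence)
open import Induction.WellFounded using (Acc; acc)
open import Relation.Binary.Definitions using (DecidableEquality)
open import Relation.Nullary using (Dec; yes; no)
open import Relation.Nullary.Decidable using (⌊_⌋; ¬?; _×-dec_; _→-dec_; decidable-stable; isYes≗does; dec-true; dec-false)
open import Relation.Unary using (Decidable)
import Relation.Binary.PropositionalEquality as ≡
open ≡ using (_≡_; _≢_; refl; cong; trans; subst₂)
open ≡.≡-Reasoning
open Equivalence using (to; from)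
open BooleanAlgebraProperties ∨-∧-booleanAlgebra using (deMorgan₂)

module _ {n : ℕ} where
  open BooleanAlgebraProperties (∪-∩-booleanAlgebra n) using (deMorgan₁; ¬-involutive)

  ∁-∩-trace : ∀ (X C : Subset n) → ∁ X ∩ C ≡ ∁ (X ∩ C) ∩ C
  ∁-∩-trace X C = begin
    ∁ X ∩ C                ≡⟨ ∪-identityʳ (∁ X ∩ C) ⟨
    ∁ X ∩ C ∪ ⊥            ≡⟨ cong (∁ X ∩ C ∪_) (∩-inverseˡ C) ⟨
    ∁ X ∩ C ∪ ∁ C ∩ C      ≡⟨ ∩-distribʳ-∪ C (∁ X) (∁ C) ⟨
    (∁ X ∪ ∁ C) ∩ C        ≡⟨ cong (_∩ C) (deMorgan₁ X C) ⟨
    ∁ (X ∩ C) ∩ C          ∎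

  ∁-∩-cong : ∀ {X Y C : Subset n} → X ∩ C ≡ Y ∩ C → ∁ X ∩ C ≡ ∁ Y ∩ C
  ∁-∩-cong {X} {Y} {C} eq = begin
    ∁ X ∩ C        ≡⟨ ∁-∩-trace X C ⟩
    ∁ (X ∩ C) ∩ C  ≡⟨ cong (λ Z → ∁ Z ∩ C) eq ⟩
    ∁ (Y ∩ C) ∩ C  ≡⟨ ∁-∩-trace Y C ⟨
    ∁ Y ∩ C        ∎

  ∁-∩-⇔ : ∀ {X Y C : Subset n} → (∁ X ∩ C ≡ ∁ Y ∩ C) ⇔ (X ∩ C ≡ Y ∩ C)
  ∁-∩-⇔ {X} {Y} {C} =
    mk⇔ (subst₂ (λ A B → A ∩ C ≡ B ∩ C) (¬-involutive X) (¬-involutive Y) ∘ ∁-∩-cong) ∁-∩-cong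

  p⊆q⇒q∩p≡p : ∀ {p q : Subset n} → p ⊆ q → q ∩ p ≡ p
  p⊆q⇒q∩p≡p {p} {q} p⊆q = ⊆-antisym (p∩q⊆q q p) (λ x∈p → x∈p∩q⁺ (p⊆q x∈p , x∈p))

  ∩-restrict : ∀ {X Y C C' : Subset n} → C ⊆ C' → X ∩ C' ≡ Y ∩ C' → X ∩ C ≡ Y ∩ C
  ∩-restrict {X} {Y} {C} {C'} C⊆C' eq = begin
    X ∩ C         ≡⟨ cong (X ∩_) (p⊆q⇒q∩p≡p C⊆C') ⟨
    X ∩ (C' ∩ C)  ≡⟨ ∩-assoc X C' C ⟨
    (X ∩ C') ∩ C  ≡⟨ cong (_∩ C) eq ⟩
    (Y ∩ C') ∩ C  ≡⟨ ∩-assoc Y C' C ⟩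
    Y ∩ (C' ∩ C)  ≡⟨ cong (Y ∩_) (p⊆q⇒q∩p≡p C⊆C') ⟩
    Y ∩ C         ∎

  ∩-nonempty-mono : ∀ {X C C' : Subset n} → C ⊆ C' → Nonempty (X ∩ C) → Nonempty (X ∩ C')
  ∩-nonempty-mono {X} {C} C⊆C' (x , x∈X∩C) = x , x∈p∩q⁺ (map₂ C⊆C' (x∈p∩q⁻ X C x∈X∩C))

  _≟ₛ_ : DecidableEquality (Subset n)
  _≟ₛ_ = ≡-dec Bool._≟_

⌊≟⌋-refl : ∀ {n} (v : Fin n) → ⌊ v ≟ v ⌋ ≡ true
⌊≟⌋-refl v = trans (isYes≗does (v ≟ v)) (dec-true (v ≟ v) refl)

⌊≟⌋-≢ : ∀ {n} {u v : Fin n} → u ≢ v → ⌊ u ≟ v ⌋ ≡ false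
⌊≟⌋-≢ {u = u} {v} u≢v = trans (isYes≗does (u ≟ v)) (dec-false (u ≟ v) u≢v)

∣p∪q∣≤∣p∣+∣q∣ : ∀ {n} (p q : Subset n) → ∣ p ∪ q ∣ ≤ ∣ p ∣ + ∣ q ∣
∣p∪q∣≤∣p∣+∣q∣ [] [] = z≤n
∣p∪q∣≤∣p∣+∣q∣ (true ∷ p) (true ∷ q) =
  s≤s (≤-trans (∣p∪q∣≤∣p∣+∣q∣ p q) (+-monoʳ-≤ ∣ p ∣ (n≤1+n ∣ q ∣)))
∣p∪q∣≤∣p∣+∣q∣ (true ∷ p) (false ∷ q) = s≤s (∣p∪q∣≤∣p∣+∣q∣ p q)
∣p∪q∣≤∣p∣+∣q∣ (false ∷ p) (true ∷ q) =
  ≤-trans (s≤s (∣p∪q∣≤∣p∣+∣q∣ p q)) (≤-reflexive (≡.sym (+-suc ∣ p ∣ ∣ q ∣)))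
∣p∪q∣≤∣p∣+∣q∣ (false ∷ p) (false ∷ q) = ∣p∪q∣≤∣p∣+∣q∣ p q

∣p∪⁅x⁆∣≤1+∣p∣ : ∀ {n} (p : Subset n) x → ∣ p ∪ ⁅ x ⁆ ∣ ≤ suc ∣ p ∣
∣p∪⁅x⁆∣≤1+∣p∣ p x = ≤-trans (∣p∪q∣≤∣p∣+∣q∣ p ⁅ x ⁆)
  (≤-reflexive (trans (cong (∣ p ∣ +_) (∣⁅x⁆∣≡1 x)) (+-comm ∣ p ∣ 1)))

minimum : ∀ {n} {P : Subset n → Set} → Decidable P → ∃ P → ∃ (IsMinimum P)
minimum {P = P} P? (C , pC) = descend C pC (<-wellFounded ∣ C ∣)
  where
  descend : ∀ C → P C → Acc _<_ ∣ C ∣ → ∃ (IsMinimum P)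
  descend C pC (acc smaller) with anySubset? (λ C' → P? C' ×-dec (∣ C' ∣ <? ∣ C ∣))
  ... | yes (C' , pC' , ∣C'∣<∣C∣) = descend C' pC' (smaller ∣C'∣<∣C∣)
  ... | no none-smaller =
    ∣ C ∣ , (C , pC , refl) , λ C' pC' → ≮⇒≥ (λ ∣C'∣<∣C∣ → none-smaller (C' , pC' , ∣C'∣<∣C∣))

_⇝_ : ∀ {n} → (Subset n → Set) → (Subset n → Set) → Set
P ⇝ Q = ∀ C → P C → ∃ λ C' → Q C' × ∣ C' ∣ ≤ suc ∣ C ∣

⇝-minimum-≤ : ∀ {n} {P Q : Subset n → Set} {a b} →
  P ⇝ Q → IsMinimum P a → IsMinimum Q b → b ≤ suc a
⇝-minimum-≤ P⇝Q ((C , pC , refl) , _) (_ , Q-lower-bound) with P⇝Q C pC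
... | C' , qC' , ∣C'∣≤1+∣C∣ = ≤-trans (Q-lower-bound C' qC') ∣C'∣≤1+∣C∣

minima-close : ∀ {n} {P Q : Subset n → Set} → Decidable P → Decidable Q →
  ∃ P → P ⇝ Q → Q ⇝ P → DefinedAndClose (IsMinimum P) (IsMinimum Q)
minima-close P? Q? P-inhabited P⇝Q Q⇝P
  with minimum P? P-inhabited | minimum Q? (map₂ proj₁ (uncurry P⇝Q P-inhabited))
... | a , a-min | b , b-min =
  a , b , a-min , b-min , ⇝-minimum-≤ Q⇝P b-min a-min , ⇝-minimum-≤ P⇝Q a-min b-min

-- Dominating G, TotalDominating G, OpenSeparating G and ClosedSeparating G are definitionally
-- Covers (N[ G ]), Covers (N G), Separates (N G) and Separates (N[ G ]).
Covers : ∀ {n} → (Fin n → Subset n) → Subset n → Set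
Covers X C = ∀ v → Nonempty (X v ∩ C)

Separates : ∀ {n} → (Fin n → Subset n) → Subset n → Set
Separates X C = ∀ u v → u ≢ v → X u ∩ C ≢ X v ∩ C

Separates-mono : ∀ {n} {X : Fin n → Subset n} {C C'} → C ⊆ C' → Separates X C → Separates X C'
Separates-mono C⊆C' sep u v u≢v = sep u v u≢v ∘ ∩-restrict C⊆C'

covers-by-adding-one : ∀ {n} (X : Fin n → Subset n) {C : Subset n} →
  (∀ v → Nonempty (X v)) → (∀ u v → Empty (X u ∩ C) → Empty (X v ∩ C) → u ≡ v) →
  ∃ λ C' → C ⊆ C' × ∣ C' ∣ ≤ suc ∣ C ∣ × Covers X C'
covers-by-adding-one {n} X {C} X-nonempty uncovered-unique
  with any? (λ v → ¬? (nonempty? (X v ∩ C)))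
... | no none-uncovered = C , ⊆-refl , n≤1+n ∣ C ∣ , λ v →
  decidable-stable (nonempty? (X v ∩ C)) (λ uncovered → none-uncovered (v , uncovered))
... | yes (b , b-uncovered) = C ∪ ⁅ w ⁆ , p⊆p∪q ⁅ w ⁆ , ∣p∪⁅x⁆∣≤1+∣p∣ C w , covered
  where
  w : Fin n
  w = proj₁ (X-nonempty b)
  covered : Covers X (C ∪ ⁅ w ⁆)
  covered v with nonempty? (X v ∩ C)
  ... | yes covered-by-C = ∩-nonempty-mono (p⊆p∪q ⁅ w ⁆) covered-by-C
  ... | no v-uncovered with uncovered-unique v b v-uncovered b-uncovered
  ...   | refl = w , x∈p∩q⁺ (proj₂ (X-nonempty b) , q⊆p∪q C ⁅ w ⁆ (x∈⁅x⁆ w))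

module _ {n : ℕ} (G : Graph n) where

  lookup-N : ∀ v w → lookup (N G v) w ≡ adj G v w
  lookup-N v = lookup∘tabulate (adj G v)

  lookup-N[] : ∀ v w → lookup (N[ G ] v) w ≡ adj G v w ∨ ⌊ v ≟ w ⌋
  lookup-N[] v = lookup∘tabulate (λ w → adj G v w ∨ ⌊ v ≟ w ⌋)

  v∈N[v] : ∀ v → v ∈ N[ G ] v
  v∈N[v] v = lookup⇒[]= v (N[ G ] v) (begin
    lookup (N[ G ] v) v        ≡⟨ lookup-N[] v v ⟩
    adj G v v ∨ ⌊ v ≟ v ⌋      ≡⟨ cong (adj G v v ∨_) (⌊≟⌋-refl v) ⟩
    adj G v v ∨ true           ≡⟨ ∨-zeroʳ (adj G v v) ⟩
    true                       ∎)

  closed-trace-outside : ∀ {u C} → u ∉ C → N[ G ] u ∩ C ≡ N G u ∩ C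
  closed-trace-outside {u} {C} u∉C = Pointwise-≡⇒≡ (ext λ w → begin
    lookup (N[ G ] u ∩ C) w               ≡⟨ lookup-zipWith _∧_ w (N[ G ] u) C ⟩
    lookup (N[ G ] u) w ∧ lookup C w      ≡⟨ cong (_∧ lookup C w) (lookup-N[] u w) ⟩
    (adj G u w ∨ ⌊ u ≟ w ⌋) ∧ lookup C w  ≡⟨ drop-self (u ≟ w) ⟩
    adj G u w ∧ lookup C w                ≡⟨ cong (_∧ lookup C w) (lookup-N u w) ⟨
    lookup (N G u) w ∧ lookup C w         ≡⟨ lookup-zipWith _∧_ w (N G u) C ⟨
    lookup (N G u ∩ C) w                  ∎)
    where
    u∉C-lookup : lookup C u ≡ false
    u∉C-lookup = ¬-not (u∉C ∘ lookup⇒[]= u C)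
    drop-self : ∀ {w} (u≟w : Dec (u ≡ w)) →
      (adj G u w ∨ ⌊ u≟w ⌋) ∧ lookup C w ≡ adj G u w ∧ lookup C w
    drop-self (yes refl) rewrite u∉C-lookup = trans (∧-zeroʳ _) (≡.sym (∧-zeroʳ _))
    drop-self (no _) = cong (_∧ lookup C _) (∨-identityʳ _)

  no-isolated⇒N-nonempty : ¬ HasIsolatedVertex G → ∀ v → Nonempty (N G v)
  no-isolated⇒N-nonempty no-isolated v = decidable-stable (nonempty? (N G v)) λ N-empty →
    no-isolated (v , λ w → ¬-not λ adjacent →
      N-empty (w , lookup⇒[]= w (N G v) (trans (lookup-N v w) adjacent)))

  Separating-mono : ∀ S {C C'} → C ⊆ C' → Separating S G C → Separating S G C'
  Separating-mono L C⊆C' loc u v u∉C' v∉C' u≢v =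
    loc u v (u∉C' ∘ C⊆C') (v∉C' ∘ C⊆C') u≢v ∘ ∩-restrict C⊆C'
  Separating-mono O C⊆C' = Separates-mono C⊆C'
  Separating-mono I C⊆C' = Separates-mono C⊆C'
  Separating-mono F C⊆C' (open-sep , closed-sep) =
    Separates-mono C⊆C' open-sep , Separates-mono C⊆C' closed-sep

  Separating⇒Locating : ∀ S {C} → Separating S G C → Locating G C
  Separating⇒Locating L loc = loc
  Separating⇒Locating O sep u v _ _ u≢v = sep u v u≢v
  Separating⇒Locating I sep u v u∉C v∉C u≢v eq =
    sep u v u≢v (trans (closed-trace-outside u∉C) (trans eq (≡.sym (closed-trace-outside v∉C))))
  Separating⇒Locating F (open-sep , _) u v _ _ u≢v = open-sep u v u≢v

  locating⇒N[]-empty-unique : ∀ {C} → Locating G C →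
    ∀ u v → Empty (N[ G ] u ∩ C) → Empty (N[ G ] v ∩ C) → u ≡ v
  locating⇒N[]-empty-unique {C} loc u v u-undominated v-undominated =
    decidable-stable (u ≟ v) λ u≢v → loc u v (outside u-undominated) (outside v-undominated) u≢v (begin
      N G u ∩ C     ≡⟨ closed-trace-outside (outside u-undominated) ⟨
      N[ G ] u ∩ C  ≡⟨ Empty-unique u-undominated ⟩
      ⊥             ≡⟨ Empty-unique v-undominated ⟨
      N[ G ] v ∩ C  ≡⟨ closed-trace-outside (outside v-undominated) ⟩
      N G v ∩ C     ∎)
    where
    outside : ∀ {x} → Empty (N[ G ] x ∩ C) → x ∉ C
    outside {x} x-undominated x∈C = x-undominated (x , x∈p∩q⁺ (v∈N[v] x , x∈C))

  open-separating⇒N-empty-unique : ∀ {C} → OpenSeparating G C →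
    ∀ u v → Empty (N G u ∩ C) → Empty (N G v ∩ C) → u ≡ v
  open-separating⇒N-empty-unique sep u v u-empty v-empty = decidable-stable (u ≟ v) λ u≢v →
    sep u v u≢v (trans (Empty-unique u-empty) (≡.sym (Empty-unique v-empty)))

  SDCode-from-separating : ∀ S → Separating S G ⇝ SDCode S G
  SDCode-from-separating S C sep
    with covers-by-adding-one (N[ G ]) (λ v → v , v∈N[v] v)
           (locating⇒N[]-empty-unique (Separating⇒Locating S sep))
  ... | C' , C⊆C' , size , dominating = C' , (dominating , Separating-mono S C⊆C' sep) , size

  FTDCode-from-full-separating : ¬ HasIsolatedVertex G → FullSeparating G ⇝ STDCode F G
  FTDCode-from-full-separating no-isolated C sep@(open-sep , _)
    with covers-by-adding-one (N G) (no-isolated⇒N-nonempty no-isolated)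
           (open-separating⇒N-empty-unique open-sep)
  ... | C' , C⊆C' , size , total = C' , (total , Separating-mono F C⊆C' sep) , size

  ⊤-dominating : Dominating G ⊤
  ⊤-dominating v = v , x∈p∩q⁺ (v∈N[v] v , ∈⊤)

  ⊤-total-dominating : ¬ HasIsolatedVertex G → TotalDominating G ⊤
  ⊤-total-dominating no-isolated v with no-isolated⇒N-nonempty no-isolated v
  ... | w , w∈N = w , x∈p∩q⁺ (w∈N , ∈⊤)

  ⊤-locating : Locating G ⊤
  ⊤-locating _ _ u∉⊤ _ _ _ = u∉⊤ ∈⊤

  ⊤-open-separating : ¬ HasOpenTwins G → OpenSeparating G ⊤
  ⊤-open-separating no-twins u v u≢v eq = no-twins (u , v , u≢v , non-adjacent , N-eq)
    where
    N-eq : N G u ≡ N G v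
    N-eq = subst₂ _≡_ (∩-identityʳ (N G u)) (∩-identityʳ (N G v)) eq
    non-adjacent : adj G u v ≡ false
    non-adjacent = begin
      adj G u v          ≡⟨ lookup-N u v ⟨
      lookup (N G u) v   ≡⟨ cong (λ X → lookup X v) N-eq ⟩
      lookup (N G v) v   ≡⟨ lookup-N v v ⟩
      adj G v v          ≡⟨ irrefl G v ⟩
      false              ∎

  ⊤-closed-separating : ¬ HasClosedTwins G → ClosedSeparating G ⊤
  ⊤-closed-separating no-twins u v u≢v eq = no-twins (u , v , u≢v , adjacent , N[]-eq)
    where
    N[]-eq : N[ G ] u ≡ N[ G ] v
    N[]-eq = subst₂ _≡_ (∩-identityʳ (N[ G ] u)) (∩-identityʳ (N[ G ] v)) eq
    adjacent : adj G u v ≡ true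
    adjacent = begin
      adj G u v               ≡⟨ sym G u v ⟩
      adj G v u               ≡⟨ ∨-identityʳ (adj G v u) ⟨
      adj G v u ∨ false       ≡⟨ cong (adj G v u ∨_) (⌊≟⌋-≢ (u≢v ∘ ≡.sym)) ⟨
      adj G v u ∨ ⌊ v ≟ u ⌋   ≡⟨ lookup-N[] v u ⟨
      lookup (N[ G ] v) u     ≡⟨ cong (λ X → lookup X u) N[]-eq ⟨
      lookup (N[ G ] u) u     ≡⟨ []=⇒lookup (v∈N[v] u) ⟩
      true                    ∎

  ⊤-full-separating : ¬ HasOpenTwins G → ¬ HasClosedTwins G → FullSeparating G ⊤
  ⊤-full-separating no-open-twins no-closed-twins =
    ⊤-open-separating no-open-twins , ⊤-closed-separating no-closed-twins

dual : Sep → Sep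
dual L = L
dual O = I
dual I = O
dual F = F

module _ {n : ℕ} (G : Graph n) where
  private
    Ḡ : Graph n
    Ḡ = complement G

  N-complement : ∀ u → N Ḡ u ≡ ∁ (N[ G ] u)
  N-complement u = trans (tabulate-cong λ w → ≡.sym (deMorgan₂ (adj G u w) ⌊ u ≟ w ⌋))
                         (tabulate-∘ not (λ w → adj G u w ∨ ⌊ u ≟ w ⌋))

  N[]-complement : ∀ u → N[ Ḡ ] u ≡ ∁ (N G u)
  N[]-complement u = trans (tabulate-cong λ w → self-or-non-neighbour (u ≟ w)) (tabulate-∘ not (adj G u))
    where
    self-or-non-neighbour : ∀ {w} (u≟w : Dec (u ≡ w)) →
      (not (adj G u w) ∧ not ⌊ u≟w ⌋) ∨ ⌊ u≟w ⌋ ≡ not (adj G u w)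
    self-or-non-neighbour (yes refl) rewrite irrefl G u = refl
    self-or-non-neighbour (no _) = trans (∨-identityʳ _) (∧-identityʳ _)

  open-trace-complement : ∀ {C} u v →
    (N Ḡ u ∩ C ≡ N Ḡ v ∩ C) ⇔ (N[ G ] u ∩ C ≡ N[ G ] v ∩ C)
  open-trace-complement u v rewrite N-complement u | N-complement v = ∁-∩-⇔

  closed-trace-complement : ∀ {C} u v →
    (N[ Ḡ ] u ∩ C ≡ N[ Ḡ ] v ∩ C) ⇔ (N G u ∩ C ≡ N G v ∩ C)
  closed-trace-complement u v rewrite N[]-complement u | N[]-complement v = ∁-∩-⇔

  outside-trace-complement : ∀ {C u v} → u ∉ C → v ∉ C →
    (N Ḡ u ∩ C ≡ N Ḡ v ∩ C) ⇔ (N G u ∩ C ≡ N G v ∩ C)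
  outside-trace-complement {u = u} {v} u∉C v∉C
    rewrite ≡.sym (closed-trace-outside G u∉C) | ≡.sym (closed-trace-outside G v∉C) =
      open-trace-complement u v

  Separating-complement : ∀ S {C} → Separating S G C ⇔ Separating (dual S) Ḡ C
  Separating-complement L = mk⇔
    (λ loc u v u∉C v∉C u≢v → loc u v u∉C v∉C u≢v ∘ to (outside-trace-complement u∉C v∉C))
    (λ loc u v u∉C v∉C u≢v → loc u v u∉C v∉C u≢v ∘ from (outside-trace-complement u∉C v∉C))
  Separating-complement O = mk⇔
    (λ sep u v u≢v → sep u v u≢v ∘ to (closed-trace-complement u v))
    (λ sep u v u≢v → sep u v u≢v ∘ from (closed-trace-complement u v))
  Separating-complement I = mk⇔
    (λ sep u v u≢v → sep u v u≢v ∘ to (open-trace-complement u v))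
    (λ sep u v u≢v → sep u v u≢v ∘ from (open-trace-complement u v))
  Separating-complement F = mk⇔
    (λ (open-sep , closed-sep) →
      to (Separating-complement I) closed-sep , to (Separating-complement O) open-sep)
    (λ (open-sep , closed-sep) →
      from (Separating-complement O) closed-sep , from (Separating-complement I) open-sep)

module _ {n : ℕ} (G : Graph n) (C : Subset n) where

  covers? : (X : Fin n → Subset n) → Dec (Covers X C)
  covers? X = all? λ v → nonempty? (X v ∩ C)

  separates? : (X : Fin n → Subset n) → Dec (Separates X C)
  separates? X = all? λ u → all? λ v → ¬? (u ≟ v) →-dec ¬? ((X u ∩ C) ≟ₛ (X v ∩ C))

  separating? : ∀ S → Dec (Separating S G C)
  separating? L = all? λ u → all? λ v →
    ¬? (u ∈? C) →-dec ¬? (v ∈? C) →-dec ¬? (u ≟ v) →-dec ¬? ((N G u ∩ C) ≟ₛ (N G v ∩ C))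
  separating? O = separates? (N G)
  separating? I = separates? (N[ G ])
  separating? F = separates? (N G) ×-dec separates? (N[ G ])

sdCode? : ∀ S {n} (G : Graph n) → Decidable (SDCode S G)
sdCode? S G C = covers? G C (N[ G ]) ×-dec separating? G C S

stdCode? : ∀ S {n} (G : Graph n) → Decidable (STDCode S G)
stdCode? S G C = covers? G C (N G) ×-dec separating? G C S

γSD-complement-close : ∀ S {n} (G : Graph n) → ∃ (SDCode S G) →
  DefinedAndClose (γSD≡ S G) (γSD≡ (dual S) (complement G))
γSD-complement-close S G code =
  minima-close (sdCode? S G) (sdCode? (dual S) (complement G)) code
    (λ C (_ , sep) → SDCode-from-separating (complement G) (dual S) C
                       (to (Separating-complement G S) sep))
    (λ C (_ , sep) → SDCode-from-separating G S C
                       (from (Separating-complement G S) sep))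

γFTD-complement-close : ∀ {n} (G : Graph n) →
  ¬ HasIsolatedVertex G → ¬ HasIsolatedVertex (complement G) → ∃ (STDCode F G) →
  DefinedAndClose (γSTD≡ F G) (γSTD≡ F (complement G))
γFTD-complement-close G G-no-isolated Ḡ-no-isolated code =
  minima-close (stdCode? F G) (stdCode? F (complement G)) code
    (λ C (_ , sep) → FTDCode-from-full-separating (complement G) Ḡ-no-isolated C
                       (to (Separating-complement G F) sep))
    (λ C (_ , sep) → FTDCode-from-full-separating G G-no-isolated C
                       (from (Separating-complement G F) sep))

corollary1 : ∀ (n : ℕ) (G : Graph n) →
    DefinedAndClose (γSD≡ L G) (γSD≡ L (complement G))
    × (¬ HasClosedTwins G → DefinedAndClose (γSD≡ I G) (γSD≡ O (complement G)))
    × (¬ HasOpenTwins G → DefinedAndClose (γSD≡ O G) (γSD≡ I (complement G)))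
    × (¬ HasOpenTwins G → ¬ HasClosedTwins G →
        DefinedAndClose (γSD≡ F G) (γSD≡ F (complement G))
        × (¬ HasIsolatedVertex G → ¬ HasIsolatedVertex (complement G) →
            DefinedAndClose (γSTD≡ F G) (γSTD≡ F (complement G))))
corollary1 n G =
  γSD-complement-close L G (⊤ , ⊤-dominating G , ⊤-locating G) ,
  (λ no-closed-twins →
    γSD-complement-close I G (⊤ , ⊤-dominating G , ⊤-closed-separating G no-closed-twins)) ,
  (λ no-open-twins →
    γSD-complement-close O G (⊤ , ⊤-dominating G , ⊤-open-separating G no-open-twins)) ,
  λ no-open-twins no-closed-twins →
    γSD-complement-close F G (⊤ , ⊤-dominating G , ⊤-full-separating G no-open-twins no-closed-twins) ,
    λ G-no-isolated Ḡ-no-isolated → γFTD-complement-close G G-no-isolated Ḡ-no-isolated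
      (⊤ , ⊤-total-dominating G G-no-isolated , ⊤-full-separating G no-open-twins no-closed-twins)
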